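{- Let $H$ be a finite graph and $a,b$ two vertices with $ab\notin E(H)$. If $p^2$ divides $\Delta_H(p)$, then $p^2$ divides $4f_{a,b,H}(p)-(p-1)^{e(H)}$.
   Context: For $p\in[0,1]$ define the kernel $U_p:[0,1]^2\to\mathbb{R}$ by $U_p(x,y)=2p-1$ if $(x,y)\in[0,1/2)^2$ or $(x,y)\in[1/2,1]^2$, and $U_p(x,y)=-1$ otherwise. For a graph $H$, $t_H(U)=\int_{[0,1]^{v(H)}}\prod_{ij\in E(H)}U(x_i,x_j)\prod_i dx_i$, and $\Delta_H(p):=t_H(U_p)-(p-1)^{e(H)}$ (note $t_{K_2}(U_p)=p-1$), a polynomial in $p$. Let $I_1=[0,1/2)$. For vertices $a,b$ define $f_{a,b,H}(p)=\int_{I_1\times I_1}\left(\int_{[0,1]^{v(H)-2}}\prod_{uv\in E(H)}U_p(x_u,x_v)\prod_{k\in V(H)\setminus\{a,b\}}dx_k\right)dx_a\,dx_b$, a polynomial in $p$. Divisibility is in the polynomial ring $\mathbb{R}[p]$. -}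

module Defs where

open import Data.Nat as ℕ using (ℕ; zero; suc; _<ᵇ_)
open import Data.Bool using (Bool; true; false; if_then_else_; _∧_)
open import Data.Fin using (Fin; toℕ) renaming (zero to fz; suc to fs)
open import Data.List using (List; []; _∷_; foldr; length; filterᵇ; concatMap; map; allFin)
open import Data.Product using (_×_; _,_; ∃)
open import Data.Rational using (ℚ; 0ℚ; 1ℚ; ½; _+_; _*_; -_)
open import Relation.Binary.PropositionalEquality using (_≡_)

record Graph : Set where
  field
    n     : ℕ
    adj   : Fin n → Fin n → Bool
    sym   : ∀ i j → adj i j ≡ adj j i
    irrefl : ∀ i → adj i i ≡ false
open Graph public

v : Graph → ℕ
v H = n H

edges : (H : Graph) → List (Fin (n H) × Fin (n H))
edges H = filterᵇ (λ { (i , j) → (toℕ i <ᵇ toℕ j) ∧ adj H i j })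
                  (concatMap (λ i → map (λ j → (i , j)) (allFin (n H))) (allFin (n H)))

e : Graph → ℕ
e H = length (edges H)

-- Polynomials in p with rational coefficients (list of coefficients,
-- index k = coefficient of p^k).  All polynomials in the paper's
-- statement have rational coefficients.

Poly : Set
Poly = List ℚ

coeff : Poly → ℕ → ℚ
coeff []       _       = 0ℚ
coeff (c ∷ _)  zero    = c
coeff (_ ∷ cs) (suc k) = coeff cs k

_⊕_ : Poly → Poly → Poly
[]       ⊕ q        = q
(c ∷ cs) ⊕ []       = c ∷ cs
(c ∷ cs) ⊕ (d ∷ ds) = (c + d) ∷ (cs ⊕ ds)

scale : ℚ → Poly → Poly
scale c = map (c *_)

_⊗_ : Poly → Poly → Poly
[]       ⊗ q = []
(c ∷ cs) ⊗ q = scale c q ⊕ (0ℚ ∷ (cs ⊗ q))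

⊖_ : Poly → Poly
⊖ q = scale (- 1ℚ) q

_⊝_ : Poly → Poly → Poly
q ⊝ r = q ⊕ (⊖ r)

const : ℚ → Poly
const c = c ∷ []

X : Poly
X = 0ℚ ∷ 1ℚ ∷ []

_^ᴾ_ : Poly → ℕ → Poly
q ^ᴾ zero  = const 1ℚ
q ^ᴾ suc k = q ⊗ (q ^ᴾ k)

pm1 : Poly
pm1 = X ⊕ const (- 1ℚ)

twoPm1 : Poly
twoPm1 = scale (1ℚ + 1ℚ) X ⊕ const (- 1ℚ)

p²∣_ : Poly → Set
p²∣ q = ∃ λ (r : Poly) → ∀ k → coeff q k ≡ coeff ((X ⊗ X) ⊗ r) k

-- U_p is constant on the blocks determined
-- by which half of [0,1] each coordinate lies in; false ↔ I₁ = [0,1/2),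
-- true ↔ [1/2,1].  Each cell σ : Fin n → Bool has measure (1/2)^n.

halfPow : ℕ → ℚ
halfPow zero    = 1ℚ
halfPow (suc k) = ½ * halfPow k

sumσ : (m : ℕ) → ((Fin m → Bool) → Poly) → Poly
sumσ zero    F = F (λ ())
sumσ (suc m) F = sumσ m (λ σ → F (ext false σ)) ⊕ sumσ m (λ σ → F (ext true σ))
  where
  ext : Bool → (Fin m → Bool) → Fin (suc m) → Bool
  ext b σ fz     = b
  ext b σ (fs i) = σ i

Ucell : Bool → Bool → Poly
Ucell false false = twoPm1
Ucell true  true  = twoPm1
Ucell false true  = const (- 1ℚ)
Ucell true  false = const (- 1ℚ)

edgeProd : (H : Graph) → (Fin (n H) → Bool) → Poly
edgeProd H σ = foldr (λ { (u , w) acc → Ucell (σ u) (σ w) ⊗ acc }) (const 1ℚ) (edges H)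

tH : Graph → Poly
tH H = scale (halfPow (n H)) (sumσ (n H) (edgeProd H))

ΔH : Graph → Poly
ΔH H = tH H ⊝ (pm1 ^ᴾ e H)

-- f_{a,b,H}(p): x_a, x_b ∈ I₁, other coordinates over [0,1]
fabH : (H : Graph) → Fin (n H) → Fin (n H) → Poly
fabH H a b = scale (halfPow (n H))
  (sumσ (n H) (λ σ → if σ a then [] else (if σ b then [] else edgeProd H σ)))

Fin' : Graph → Set
Fin' H = Fin (n H)

-- Compare both sides to first order at p = 0.  There U_p ≡ -1, and a factor
-- U_p(x,y) has linear coefficient 2·[x and y lie in the same half], so the
-- integrand ∏_{uv∈E} U_p has constant term (-1)^e and linear coefficient
-- -(-1)^e · Σ_{uv∈E} 2·[x_u, x_v in the same half].  Conditioned on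
-- x_a, x_b ∈ I₁ (a quarter of the cube), every edge still has an endpoint
-- outside {a, b}, because ab ∉ E; the half of that endpoint is a fair coin, so
-- the edge's endpoints agree with probability 1/2.  Hence 4 f_{a,b,H} has the
-- same constant and linear coefficients as (p - 1)^e.

module Submission where

open import Defs renaming (sym to adj-sym)
open import Data.Bool using (Bool; true; false; not; if_then_else_; T; T?; _∧_)
open import Data.Bool.Properties using (T-≡; T-∧; not-¬)
open import Data.Fin using (Fin; toℕ; _≟_) renaming (zero to fz; suc to fs)
open import Data.List using (List; []; _∷_; foldr; length; map; drop; concatMap; allFin)
open import Data.List.Relation.Unary.All as All using (All; []; _∷_)
open import Data.List.Relation.Unary.All.Properties using (all-filter)
open import Data.Nat using (ℕ; zero; suc; _<ᵇ_)
open import Data.Nat.Properties using (<ᵇ⇒<; <⇒≢)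
open import Data.Product using (_×_; _,_; proj₁; proj₂)
open import Data.Rational using (ℚ; 0ℚ; 1ℚ; ½; _+_; _*_; -_; +-*-rawSemiring)
open import Data.Rational.Properties
  using (+-identityˡ; +-identityʳ; *-identityˡ; *-identityʳ; *-zeroˡ; *-zeroʳ; +-comm; *-comm; *-assoc;
         *-distribˡ-+; *-distribʳ-+; neg-distribˡ-*)
open import Data.Rational.Solver using (module +-*-Solver)
open import Data.Sum using (_⊎_; inj₁; inj₂)
open import Algebra.Definitions.RawSemiring +-*-rawSemiring using (_^_)
open import Function using (_∘_; Equivalence)
open import Relation.Binary.PropositionalEquality
open import Relation.Nullary using (yes; no; contradiction)
open +-*-Solver using (solve; _:=_; _:+_; _:*_; :-_; con)

coeff-⊕ : ∀ q r k → coeff (q ⊕ r) k ≡ coeff q k + coeff r k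
coeff-⊕ []       r        k       = sym (+-identityˡ _)
coeff-⊕ (c ∷ cs) []       k       = sym (+-identityʳ _)
coeff-⊕ (c ∷ cs) (d ∷ ds) zero    = refl
coeff-⊕ (c ∷ cs) (d ∷ ds) (suc k) = coeff-⊕ cs ds k

coeff-scale : ∀ c q k → coeff (scale c q) k ≡ c * coeff q k
coeff-scale c []       k       = sym (*-zeroʳ c)
coeff-scale c (d ∷ ds) zero    = refl
coeff-scale c (d ∷ ds) (suc k) = coeff-scale c ds k

coeff-⊝ : ∀ q r k → coeff q k ≡ coeff r k → coeff (q ⊝ r) k ≡ 0ℚ
coeff-⊝ q r k q≡r = begin
  coeff (q ⊝ r) k                      ≡⟨ coeff-⊕ q (⊖ r) k ⟩
  coeff q k + coeff (⊖ r) k            ≡⟨ cong₂ _+_ q≡r (coeff-scale (- 1ℚ) r k) ⟩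
  coeff r k + (- 1ℚ) * coeff r k       ≡⟨ solve 1 (λ x → x :+ con (- 1ℚ) :* x := con 0ℚ) refl (coeff r k) ⟩
  0ℚ                                   ∎
  where open ≡-Reasoning

coeff-∷-⊗ : ∀ c q r k → coeff ((c ∷ q) ⊗ r) k ≡ c * coeff r k + coeff (0ℚ ∷ (q ⊗ r)) k
coeff-∷-⊗ c q r k = trans (coeff-⊕ (scale c r) _ k) (cong (_+ coeff (0ℚ ∷ (q ⊗ r)) k) (coeff-scale c r k))

coeff₀-⊗ : ∀ q r → coeff (q ⊗ r) 0 ≡ coeff q 0 * coeff r 0
coeff₀-⊗ []      r = sym (*-zeroˡ (coeff r 0))
coeff₀-⊗ (c ∷ q) r = trans (coeff-∷-⊗ c q r 0) (+-identityʳ _)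

coeff₁-⊗ : ∀ q r → coeff (q ⊗ r) 1 ≡ coeff q 0 * coeff r 1 + coeff q 1 * coeff r 0
coeff₁-⊗ []      r = solve 2 (λ x y → con 0ℚ := con 0ℚ :* x :+ con 0ℚ :* y) refl (coeff r 1) (coeff r 0)
coeff₁-⊗ (c ∷ q) r = trans (coeff-∷-⊗ c q r 1) (cong (c * coeff r 1 +_) (coeff₀-⊗ q r))

coeff-0∷-⊗ : ∀ q r k → coeff ((0ℚ ∷ q) ⊗ r) k ≡ coeff (0ℚ ∷ (q ⊗ r)) k
coeff-0∷-⊗ q r k = trans (coeff-∷-⊗ 0ℚ q r k)
  (trans (cong (_+ coeff (0ℚ ∷ (q ⊗ r)) k) (*-zeroˡ (coeff r k))) (+-identityˡ _))

coeff-1-⊗ : ∀ r k → coeff (const 1ℚ ⊗ r) k ≡ coeff r k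
coeff-1-⊗ r zero    = trans (coeff-∷-⊗ 1ℚ [] r 0) (trans (+-identityʳ (1ℚ * coeff r 0)) (*-identityˡ _))
coeff-1-⊗ r (suc k) = trans (coeff-∷-⊗ 1ℚ [] r (suc k)) (trans (+-identityʳ (1ℚ * coeff r (suc k))) (*-identityˡ _))

coeff-X²-⊗ : ∀ r k → coeff ((X ⊗ X) ⊗ r) k ≡ coeff (0ℚ ∷ 0ℚ ∷ r) k
coeff-X²-⊗ r zero          = coeff-0∷-⊗ (0ℚ ∷ 1ℚ ∷ []) r 0
coeff-X²-⊗ r (suc zero)    = trans (coeff-0∷-⊗ (0ℚ ∷ 1ℚ ∷ []) r 1) (coeff-0∷-⊗ (1ℚ ∷ []) r 0)
coeff-X²-⊗ r (suc (suc k)) = trans (coeff-0∷-⊗ (0ℚ ∷ 1ℚ ∷ []) r (suc (suc k)))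
  (trans (coeff-0∷-⊗ (1ℚ ∷ []) r (suc k)) (coeff-1-⊗ r k))

coeff-drop-2 : ∀ q k → coeff q (suc (suc k)) ≡ coeff (drop 2 q) k
coeff-drop-2 []           k = refl
coeff-drop-2 (x ∷ [])     k = refl
coeff-drop-2 (x ∷ y ∷ zs) k = refl

p²∣-intro : ∀ q → coeff q 0 ≡ 0ℚ → coeff q 1 ≡ 0ℚ → p²∣ q
p²∣-intro q q₀ q₁ = drop 2 q , λ k → trans (low-coeffs k) (sym (coeff-X²-⊗ (drop 2 q) k))
  where
  low-coeffs : ∀ k → coeff q k ≡ coeff (0ℚ ∷ 0ℚ ∷ drop 2 q) k
  low-coeffs zero          = q₀
  low-coeffs (suc zero)    = q₁
  low-coeffs (suc (suc k)) = coeff-drop-2 q k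

sumℚ : List ℚ → ℚ
sumℚ = foldr _+_ 0ℚ

sumℚ-congᴬ : {A : Set} {f g : A → ℚ} {L : List A} → All (λ x → f x ≡ g x) L → sumℚ (map f L) ≡ sumℚ (map g L)
sumℚ-congᴬ []           = refl
sumℚ-congᴬ (fx≡gx ∷ f≡g) = cong₂ _+_ fx≡gx (sumℚ-congᴬ f≡g)

*-sumℚ : ∀ c {A : Set} (f : A → ℚ) L → c * sumℚ (map f L) ≡ sumℚ (map (λ x → c * f x) L)
*-sumℚ c f []      = *-zeroʳ c
*-sumℚ c f (x ∷ L) = trans (*-distribˡ-+ c (f x) (sumℚ (map f L))) (cong (c * f x +_) (*-sumℚ c f L))

∏ᴾ : {A : Set} → (A → Poly) → List A → Poly
∏ᴾ P = foldr (λ x acc → P x ⊗ acc) (const 1ℚ)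

∏ᴾ-cong : {A : Set} {P Q : A → Poly} → (∀ x → P x ≡ Q x) → ∀ L → ∏ᴾ P L ≡ ∏ᴾ Q L
∏ᴾ-cong P≡Q []      = refl
∏ᴾ-cong P≡Q (x ∷ L) = cong₂ _⊗_ (P≡Q x) (∏ᴾ-cong P≡Q L)

^ᴾ-length : ∀ q {A : Set} (L : List A) → q ^ᴾ length L ≡ ∏ᴾ (λ _ → q) L
^ᴾ-length q []      = refl
^ᴾ-length q (x ∷ L) = cong (q ⊗_) (^ᴾ-length q L)

module _ {A : Set} (P : A → Poly) (P₀ : ∀ x → coeff (P x) 0 ≡ - 1ℚ) where

  coeff₀-∏ᴾ : ∀ L → coeff (∏ᴾ P L) 0 ≡ (- 1ℚ) ^ length L
  coeff₀-∏ᴾ []      = refl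
  coeff₀-∏ᴾ (x ∷ L) = trans (coeff₀-⊗ (P x) (∏ᴾ P L)) (cong₂ _*_ (P₀ x) (coeff₀-∏ᴾ L))

  coeff₁-∏ᴾ : ∀ L → coeff (∏ᴾ P L) 1 ≡ - ((- 1ℚ) ^ length L * sumℚ (map (λ x → coeff (P x) 1) L))
  coeff₁-∏ᴾ []      = refl
  coeff₁-∏ᴾ (x ∷ L) = begin
    coeff (P x ⊗ ∏ᴾ P L) 1
      ≡⟨ coeff₁-⊗ (P x) (∏ᴾ P L) ⟩
    coeff (P x) 0 * coeff (∏ᴾ P L) 1 + coeff (P x) 1 * coeff (∏ᴾ P L) 0
      ≡⟨ cong₂ (λ c₀ r₁ → c₀ * r₁ + coeff (P x) 1 * coeff (∏ᴾ P L) 0) (P₀ x) (coeff₁-∏ᴾ L) ⟩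
    (- 1ℚ) * (- (s * S)) + coeff (P x) 1 * coeff (∏ᴾ P L) 0
      ≡⟨ cong (λ r₀ → (- 1ℚ) * (- (s * S)) + coeff (P x) 1 * r₀) (coeff₀-∏ᴾ L) ⟩
    (- 1ℚ) * (- (s * S)) + coeff (P x) 1 * s
      ≡⟨ solve 3 (λ s S c → con (- 1ℚ) :* (:- (s :* S)) :+ c :* s := :- ((con (- 1ℚ) :* s) :* (c :+ S)))
               refl s S (coeff (P x) 1) ⟩
    - ((- 1ℚ) * s * (coeff (P x) 1 + S))
      ∎
    where
    open ≡-Reasoning
    s = (- 1ℚ) ^ length L
    S = sumℚ (map (λ x → coeff (P x) 1) L)

-- Sums over the Boolean cube

Cube : ℕ → Set
Cube m = Fin m → Bool

_◂_ : ∀ {m} → Bool → Cube m → Cube (suc m)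
(x ◂ σ) fz     = x
(x ◂ σ) (fs i) = σ i

cubeSum : ∀ m → (Cube m → ℚ) → ℚ
cubeSum zero    G = G (λ ())
cubeSum (suc m) G = cubeSum m (λ σ → G (false ◂ σ)) + cubeSum m (λ σ → G (true ◂ σ))

◂-cong : ∀ {m} x {σ τ : Cube m} → σ ≗ τ → (x ◂ σ) ≗ (x ◂ τ)
◂-cong x σ≗τ fz     = refl
◂-cong x σ≗τ (fs i) = σ≗τ i

cubeSum-cong : ∀ m {G G′ : Cube m → ℚ} → (∀ σ → G σ ≡ G′ σ) → cubeSum m G ≡ cubeSum m G′
cubeSum-cong zero    G≡G′ = G≡G′ _
cubeSum-cong (suc m) G≡G′ = cong₂ _+_ (cubeSum-cong m (G≡G′ ∘ (false ◂_))) (cubeSum-cong m (G≡G′ ∘ (true ◂_)))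

cubeSum-+ : ∀ m (G G′ : Cube m → ℚ) → cubeSum m (λ σ → G σ + G′ σ) ≡ cubeSum m G + cubeSum m G′
cubeSum-+ zero    G G′ = refl
cubeSum-+ (suc m) G G′ = trans (cong₂ _+_ (cubeSum-+ m G₀ G₀′) (cubeSum-+ m G₁ G₁′))
  (solve 4 (λ a b c d → (a :+ b) :+ (c :+ d) := (a :+ c) :+ (b :+ d)) refl
     (cubeSum m G₀) (cubeSum m G₀′) (cubeSum m G₁) (cubeSum m G₁′))
  where
  G₀ G₀′ G₁ G₁′ : Cube m → ℚ
  G₀  = G  ∘ (false ◂_)
  G₀′ = G′ ∘ (false ◂_)
  G₁  = G  ∘ (true ◂_)
  G₁′ = G′ ∘ (true ◂_)

cubeSum-*ˡ : ∀ m c (G : Cube m → ℚ) → cubeSum m (λ σ → c * G σ) ≡ c * cubeSum m G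
cubeSum-*ˡ zero    c G = refl
cubeSum-*ˡ (suc m) c G = trans (cong₂ _+_ (cubeSum-*ˡ m c (G ∘ (false ◂_))) (cubeSum-*ˡ m c (G ∘ (true ◂_))))
  (sym (*-distribˡ-+ c (cubeSum m (G ∘ (false ◂_))) (cubeSum m (G ∘ (true ◂_)))))

cubeSum-0 : ∀ m → cubeSum m (λ _ → 0ℚ) ≡ 0ℚ
cubeSum-0 zero    = refl
cubeSum-0 (suc m) = cong₂ _+_ (cubeSum-0 m) (cubeSum-0 m)

cubeSum-sumℚ : ∀ m {A : Set} (D : A → Cube m → ℚ) L →
               cubeSum m (λ σ → sumℚ (map (λ x → D x σ) L)) ≡ sumℚ (map (λ x → cubeSum m (D x)) L)
cubeSum-sumℚ m D []      = cubeSum-0 m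
cubeSum-sumℚ m D (x ∷ L) =
  trans (cubeSum-+ m (D x) (λ σ → sumℚ (map (λ y → D y σ) L))) (cong (cubeSum m (D x) +_) (cubeSum-sumℚ m D L))

halfPow-cubeSum-1 : ∀ m → halfPow m * cubeSum m (λ _ → 1ℚ) ≡ 1ℚ
halfPow-cubeSum-1 zero    = refl
halfPow-cubeSum-1 (suc m) = trans
  (solve 2 (λ h S → (con ½ :* h) :* (S :+ S) := h :* S) refl (halfPow m) (cubeSum m (λ _ → 1ℚ)))
  (halfPow-cubeSum-1 m)

-- sumσ extends cells by a function private to Defs, so without function
-- extensionality it agrees with cubeSum only on integrands respecting _≗_.
coeff-sumσ : ∀ m (F : Cube m → Poly) k → (∀ {σ τ} → σ ≗ τ → F σ ≡ F τ) →
             coeff (sumσ m F) k ≡ cubeSum m (λ σ → coeff (F σ) k)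
coeff-sumσ zero    F k F-cong = cong (λ P → coeff P k) (F-cong (λ ()))
coeff-sumσ (suc m) F k F-cong =
  trans (coeff-⊕ (sumσ m _) (sumσ m _) k)
        (cong₂ _+_ (half false _ (λ _ → λ { fz → refl ; (fs i) → refl }))
                   (half true  _ (λ _ → λ { fz → refl ; (fs i) → refl })))
  where
  half : ∀ x (ext : Cube m → Cube (suc m)) → (∀ σ → ext σ ≗ (x ◂ σ)) →
         coeff (sumσ m (F ∘ ext)) k ≡ cubeSum m (λ σ → coeff (F (x ◂ σ)) k)
  half x ext ext≗◂ = trans (coeff-sumσ m (F ∘ ext) k (F-cong ∘ ext-cong))
                           (cubeSum-cong m (λ σ → cong (λ P → coeff P k) (F-cong (ext≗◂ σ))))
    where
    ext-cong : ∀ {σ τ} → σ ≗ τ → ext σ ≗ ext τ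
    ext-cong {σ} {τ} σ≗τ i = trans (ext≗◂ σ i) (trans (◂-cong x σ≗τ i) (sym (ext≗◂ τ i)))

toggle : ∀ {m} → Fin m → Cube m → Cube m
toggle fz     σ = not (σ fz) ◂ (σ ∘ fs)
toggle (fs j) σ = σ fz ◂ toggle j (σ ∘ fs)

toggle-same : ∀ {m} (j : Fin m) σ → toggle j σ j ≡ not (σ j)
toggle-same fz     σ = refl
toggle-same (fs j) σ = toggle-same j (σ ∘ fs)

toggle-other : ∀ {m} {i j : Fin m} σ → i ≢ j → toggle j σ i ≡ σ i
toggle-other {i = fz}   {fz}   σ i≢j = contradiction refl i≢j
toggle-other {i = fs i} {fz}   σ i≢j = refl
toggle-other {i = fz}   {fs j} σ i≢j = refl
toggle-other {i = fs i} {fs j} σ i≢j = toggle-other (σ ∘ fs) (i≢j ∘ cong fs)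

cubeSum-toggle : ∀ m j (G : Cube m → ℚ) → cubeSum m G ≡ cubeSum m (G ∘ toggle j)
cubeSum-toggle (suc m) fz     G = +-comm (cubeSum m (G ∘ (false ◂_))) (cubeSum m (G ∘ (true ◂_)))
cubeSum-toggle (suc m) (fs j) G = cong₂ _+_ (cubeSum-toggle m j _) (cubeSum-toggle m j _)

cubeSum-halve : ∀ m j (F G : Cube m → ℚ) → (∀ σ → F σ + F (toggle j σ) ≡ G σ) →
                cubeSum m F ≡ ½ * cubeSum m G
cubeSum-halve m j F G F+F∘toggle≡G = begin
  cubeSum m F                                  ≡⟨ solve 1 (λ x → x := con ½ :* (x :+ x)) refl (cubeSum m F) ⟩
  ½ * (cubeSum m F + cubeSum m F)              ≡⟨ cong (λ y → ½ * (cubeSum m F + y)) (cubeSum-toggle m j F) ⟩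
  ½ * (cubeSum m F + cubeSum m (F ∘ toggle j)) ≡⟨ cong (½ *_) (sym (cubeSum-+ m F (F ∘ toggle j))) ⟩
  ½ * cubeSum m (λ σ → F σ + F (toggle j σ))   ≡⟨ cong (½ *_) (cubeSum-cong m F+F∘toggle≡G) ⟩
  ½ * cubeSum m G                              ∎
  where open ≡-Reasoning

cubeSum-halve-at : ∀ m j (A : Bool → Cube m → ℚ) (R : Cube m → ℚ) →
                   (∀ x σ → A x σ + A (not x) σ ≡ 1ℚ) →
                   (∀ x σ → A x (toggle j σ) ≡ A x σ) → (∀ σ → R (toggle j σ) ≡ R σ) →
                   cubeSum m (λ σ → A (σ j) σ * R σ) ≡ ½ * cubeSum m R
cubeSum-halve-at m j A R A-sum A-inv R-inv = cubeSum-halve m j _ R λ σ → begin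
  A (σ j) σ * R σ + A (toggle j σ j) (toggle j σ) * R (toggle j σ)
    ≡⟨ cong₂ (λ x r → A (σ j) σ * R σ + x * r)
             (trans (cong (λ y → A y (toggle j σ)) (toggle-same j σ)) (A-inv (not (σ j)) σ)) (R-inv σ) ⟩
  A (σ j) σ * R σ + A (not (σ j)) σ * R σ
    ≡⟨ sym (*-distribʳ-+ (R σ) (A (σ j) σ) (A (not (σ j)) σ)) ⟩
  (A (σ j) σ + A (not (σ j)) σ) * R σ
    ≡⟨ trans (cong (_* R σ) (A-sum (σ j) σ)) (*-identityˡ (R σ)) ⟩
  R σ ∎
  where open ≡-Reasoning

inI₁ : Bool → ℚ
inI₁ false = 1ℚ
inI₁ true  = 0ℚ

δ : Bool → Bool → ℚ
δ false false = 1ℚ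
δ false true  = 0ℚ
δ true  false = 0ℚ
δ true  true  = 1ℚ

inI₁-not : ∀ x → inI₁ x + inI₁ (not x) ≡ 1ℚ
inI₁-not false = refl
inI₁-not true  = refl

δ-not : ∀ x y → δ x y + δ (not x) y ≡ 1ℚ
δ-not false false = refl
δ-not false true  = refl
δ-not true  false = refl
δ-not true  true  = refl

δ-comm : ∀ x y → δ x y ≡ δ y x
δ-comm false false = refl
δ-comm false true  = refl
δ-comm true  false = refl
δ-comm true  true  = refl

coeff₀-Ucell : ∀ x y → coeff (Ucell x y) 0 ≡ - 1ℚ
coeff₀-Ucell false false = refl
coeff₀-Ucell false true  = refl
coeff₀-Ucell true  false = refl
coeff₀-Ucell true  true  = refl

coeff₁-Ucell : ∀ x y → coeff (Ucell x y) 1 ≡ (1ℚ + 1ℚ) * δ x y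
coeff₁-Ucell false false = refl
coeff₁-Ucell false true  = refl
coeff₁-Ucell true  false = refl
coeff₁-Ucell true  true  = refl

coeff-if-[] : ∀ x P k → coeff (if x then [] else P) k ≡ inI₁ x * coeff P k
coeff-if-[] false P k = sym (*-identityˡ (coeff P k))
coeff-if-[] true  P k = sym (*-zeroˡ (coeff P k))

edges-adjacent : ∀ H → All (λ x → proj₁ x ≢ proj₂ x × adj H (proj₁ x) (proj₂ x) ≡ true) (edges H)
edges-adjacent H = All.map adjacent (all-filter (T? ∘ isEdge) allPairs)
  where
  allPairs : List (Fin (n H) × Fin (n H))
  allPairs = concatMap (λ i → map (i ,_) (allFin (n H))) (allFin (n H))

  isEdge : Fin (n H) × Fin (n H) → Bool
  isEdge x = (toℕ (proj₁ x) <ᵇ toℕ (proj₂ x)) ∧ adj H (proj₁ x) (proj₂ x)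

  adjacent : ∀ {x} → T (isEdge x) → proj₁ x ≢ proj₂ x × adj H (proj₁ x) (proj₂ x) ≡ true
  adjacent isEdge-x with Equivalence.to T-∧ isEdge-x
  ... | u<w , uw∈E = (λ u≡w → <⇒≢ (<ᵇ⇒< _ _ u<w) (cong toℕ u≡w)) , Equivalence.to T-≡ uw∈E

edge-avoids-non-edge : ∀ H {a b u w} → adj H a b ≡ false → u ≢ w → adj H u w ≡ true →
                       (u ≢ a × u ≢ b) ⊎ (w ≢ a × w ≢ b)
edge-avoids-non-edge H {a} {b} {u} {w} ab∉E u≢w uw∈E with u ≟ a | u ≟ b
... | yes refl | _        = inj₂ ((λ { refl → u≢w refl }) , λ { refl → not-¬ uw∈E ab∉E })
... | no u≢a   | yes refl = inj₂ ((λ { refl → not-¬ uw∈E (trans (adj-sym H b a) ab∉E) }) , λ { refl → u≢w refl })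
... | no u≢a   | no u≢b   = inj₁ (u≢a , u≢b)

edgeProd-cong : ∀ H {σ τ} → σ ≗ τ → edgeProd H σ ≡ edgeProd H τ
edgeProd-cong H σ≗τ = ∏ᴾ-cong (λ x → cong₂ Ucell (σ≗τ (proj₁ x)) (σ≗τ (proj₂ x))) (edges H)

-- Averaging over the cells with x_a, x_b ∈ I₁

module SelectedPair (H : Graph) (a b : Fin (n H)) (a≢b : a ≢ b) (ab∉E : adj H a b ≡ false) where

  N : ℕ
  N = n H

  W : Cube N → ℚ
  W σ = inI₁ (σ a) * inI₁ (σ b)

  W-toggle : ∀ {u} → u ≢ a → u ≢ b → ∀ σ → W (toggle u σ) ≡ W σ
  W-toggle u≢a u≢b σ =
    cong₂ (λ x y → inI₁ x * inI₁ y) (toggle-other σ (u≢a ∘ sym)) (toggle-other σ (u≢b ∘ sym))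

  cubeSum-W : cubeSum N W ≡ ½ * (½ * cubeSum N (λ _ → 1ℚ))
  cubeSum-W = begin
    cubeSum N W
      ≡⟨ cubeSum-halve-at N a (λ x _ → inI₁ x) (λ σ → inI₁ (σ b))
           (λ x _ → inI₁-not x) (λ _ _ → refl) (λ σ → cong inI₁ (toggle-other σ (a≢b ∘ sym))) ⟩
    ½ * cubeSum N (λ σ → inI₁ (σ b))
      ≡⟨ cong (½ *_) (cubeSum-cong N (λ σ → sym (*-identityʳ (inI₁ (σ b))))) ⟩
    ½ * cubeSum N (λ σ → inI₁ (σ b) * 1ℚ)
      ≡⟨ cong (½ *_) (cubeSum-halve-at N b (λ x _ → inI₁ x) (λ _ → 1ℚ) (λ x _ → inI₁-not x) (λ _ _ → refl) (λ _ → refl)) ⟩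
    ½ * (½ * cubeSum N (λ _ → 1ℚ))
      ∎
    where open ≡-Reasoning

  κ : ℚ
  κ = (1ℚ + 1ℚ + 1ℚ + 1ℚ) * halfPow N

  κ-cubeSum-W : κ * cubeSum N W ≡ 1ℚ
  κ-cubeSum-W = begin
    κ * cubeSum N W                                             ≡⟨ cong (κ *_) cubeSum-W ⟩
    (1ℚ + 1ℚ + 1ℚ + 1ℚ) * halfPow N * (½ * (½ * cubeSum N (λ _ → 1ℚ)))
      ≡⟨ solve 2 (λ h S → con (1ℚ + 1ℚ + 1ℚ + 1ℚ) :* h :* (con ½ :* (con ½ :* S)) := h :* S) refl
               (halfPow N) (cubeSum N (λ _ → 1ℚ)) ⟩
    halfPow N * cubeSum N (λ _ → 1ℚ)                            ≡⟨ halfPow-cubeSum-1 N ⟩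
    1ℚ                                                          ∎
    where open ≡-Reasoning

  𝔼₁ : (Cube N → ℚ) → ℚ
  𝔼₁ G = κ * cubeSum N (λ σ → W σ * G σ)

  𝔼₁-cong : ∀ {G G′} → (∀ σ → G σ ≡ G′ σ) → 𝔼₁ G ≡ 𝔼₁ G′
  𝔼₁-cong G≡G′ = cong (κ *_) (cubeSum-cong N (λ σ → cong (W σ *_) (G≡G′ σ)))

  𝔼₁-*ˡ : ∀ c G → 𝔼₁ (λ σ → c * G σ) ≡ c * 𝔼₁ G
  𝔼₁-*ˡ c G = begin
    κ * cubeSum N (λ σ → W σ * (c * G σ))
      ≡⟨ cong (κ *_) (cubeSum-cong N (λ σ → solve 3 (λ w c g → w :* (c :* g) := c :* (w :* g)) refl (W σ) c (G σ))) ⟩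
    κ * cubeSum N (λ σ → c * (W σ * G σ))
      ≡⟨ cong (κ *_) (cubeSum-*ˡ N c (λ σ → W σ * G σ)) ⟩
    κ * (c * cubeSum N (λ σ → W σ * G σ))
      ≡⟨ solve 3 (λ k c x → k :* (c :* x) := c :* (k :* x)) refl κ c (cubeSum N (λ σ → W σ * G σ)) ⟩
    c * 𝔼₁ G
      ∎
    where open ≡-Reasoning

  𝔼₁-const : ∀ c → 𝔼₁ (λ _ → c) ≡ c
  𝔼₁-const c = begin
    𝔼₁ (λ _ → c)          ≡⟨ 𝔼₁-cong (λ _ → sym (*-identityʳ c)) ⟩
    𝔼₁ (λ _ → c * 1ℚ)     ≡⟨ 𝔼₁-*ˡ c (λ _ → 1ℚ) ⟩
    c * 𝔼₁ (λ _ → 1ℚ)     ≡⟨ cong (λ x → c * (κ * x)) (cubeSum-cong N (λ σ → *-identityʳ (W σ))) ⟩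
    c * (κ * cubeSum N W) ≡⟨ cong (c *_) κ-cubeSum-W ⟩
    c * 1ℚ                ≡⟨ *-identityʳ c ⟩
    c                     ∎
    where open ≡-Reasoning

  𝔼₁-sumℚ : ∀ {A : Set} (D : A → Cube N → ℚ) L →
            𝔼₁ (λ σ → sumℚ (map (λ x → D x σ) L)) ≡ sumℚ (map (λ x → 𝔼₁ (D x)) L)
  𝔼₁-sumℚ D L = begin
    κ * cubeSum N (λ σ → W σ * sumℚ (map (λ x → D x σ) L))
      ≡⟨ cong (κ *_) (cubeSum-cong N (λ σ → *-sumℚ (W σ) (λ x → D x σ) L)) ⟩
    κ * cubeSum N (λ σ → sumℚ (map (λ x → W σ * D x σ) L))
      ≡⟨ cong (κ *_) (cubeSum-sumℚ N (λ x σ → W σ * D x σ) L) ⟩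
    κ * sumℚ (map (λ x → cubeSum N (λ σ → W σ * D x σ)) L)
      ≡⟨ *-sumℚ κ (λ x → cubeSum N (λ σ → W σ * D x σ)) L ⟩
    sumℚ (map (λ x → 𝔼₁ (D x)) L)
      ∎
    where open ≡-Reasoning

  𝔼₁-δ : ∀ {u w} → u ≢ w → u ≢ a → u ≢ b → 𝔼₁ (λ σ → δ (σ u) (σ w)) ≡ ½
  𝔼₁-δ {u} {w} u≢w u≢a u≢b = begin
    κ * cubeSum N (λ σ → W σ * δ (σ u) (σ w))
      ≡⟨ cong (κ *_) (cubeSum-cong N (λ σ → *-comm (W σ) (δ (σ u) (σ w)))) ⟩
    κ * cubeSum N (λ σ → δ (σ u) (σ w) * W σ)
      ≡⟨ cong (κ *_) (cubeSum-halve-at N u (λ x σ → δ x (σ w)) W (λ x σ → δ-not x (σ w))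
                        (λ x σ → cong (δ x) (toggle-other σ (u≢w ∘ sym))) (W-toggle u≢a u≢b)) ⟩
    κ * (½ * cubeSum N W)
      ≡⟨ solve 2 (λ k x → k :* (con ½ :* x) := con ½ :* (k :* x)) refl κ (cubeSum N W) ⟩
    ½ * (κ * cubeSum N W)
      ≡⟨ cong (½ *_) κ-cubeSum-W ⟩
    ½ * 1ℚ
      ∎
    where open ≡-Reasoning

  𝔼₁-coeff₁-Ucell : ∀ {u w} → u ≢ w → adj H u w ≡ true → 𝔼₁ (λ σ → coeff (Ucell (σ u) (σ w)) 1) ≡ 1ℚ
  𝔼₁-coeff₁-Ucell {u} {w} u≢w uw∈E = begin
    𝔼₁ (λ σ → coeff (Ucell (σ u) (σ w)) 1)   ≡⟨ 𝔼₁-cong (λ σ → coeff₁-Ucell (σ u) (σ w)) ⟩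
    𝔼₁ (λ σ → (1ℚ + 1ℚ) * δ (σ u) (σ w))    ≡⟨ 𝔼₁-*ˡ (1ℚ + 1ℚ) (λ σ → δ (σ u) (σ w)) ⟩
    (1ℚ + 1ℚ) * 𝔼₁ (λ σ → δ (σ u) (σ w))    ≡⟨ cong ((1ℚ + 1ℚ) *_) 𝔼₁-δ-edge ⟩
    (1ℚ + 1ℚ) * ½                           ∎
    where
    open ≡-Reasoning
    𝔼₁-δ-edge : 𝔼₁ (λ σ → δ (σ u) (σ w)) ≡ ½
    𝔼₁-δ-edge with edge-avoids-non-edge H ab∉E u≢w uw∈E
    ... | inj₁ (u≢a , u≢b) = 𝔼₁-δ u≢w u≢a u≢b
    ... | inj₂ (w≢a , w≢b) = trans (𝔼₁-cong (λ σ → δ-comm (σ u) (σ w))) (𝔼₁-δ (u≢w ∘ sym) w≢a w≢b)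

  coeff-4fab : ∀ k → coeff (scale (1ℚ + 1ℚ + 1ℚ + 1ℚ) (fabH H a b)) k ≡ 𝔼₁ (λ σ → coeff (edgeProd H σ) k)
  coeff-4fab k = begin
    coeff (scale four (scale (halfPow N) (sumσ N integrand))) k
      ≡⟨ trans (coeff-scale four (scale (halfPow N) (sumσ N integrand)) k)
               (cong (four *_) (coeff-scale (halfPow N) (sumσ N integrand) k)) ⟩
    four * (halfPow N * coeff (sumσ N integrand) k)
      ≡⟨ cong (λ x → four * (halfPow N * x)) (coeff-sumσ N integrand k integrand-cong) ⟩
    four * (halfPow N * cubeSum N (λ σ → coeff (integrand σ) k))
      ≡⟨ cong (λ x → four * (halfPow N * x)) (cubeSum-cong N coeff-integrand) ⟩
    four * (halfPow N * cubeSum N (λ σ → W σ * coeff (edgeProd H σ) k))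
      ≡⟨ sym (*-assoc four (halfPow N) _) ⟩
    𝔼₁ (λ σ → coeff (edgeProd H σ) k)
      ∎
    where
    open ≡-Reasoning
    four = 1ℚ + 1ℚ + 1ℚ + 1ℚ

    integrand : Cube N → Poly
    integrand σ = if σ a then [] else (if σ b then [] else edgeProd H σ)

    integrand-cong : ∀ {σ τ} → σ ≗ τ → integrand σ ≡ integrand τ
    integrand-cong {σ} {τ} σ≗τ rewrite σ≗τ a | σ≗τ b | edgeProd-cong H σ≗τ = refl

    coeff-integrand : ∀ σ → coeff (integrand σ) k ≡ W σ * coeff (edgeProd H σ) k
    coeff-integrand σ = trans (coeff-if-[] (σ a) _ k)
      (trans (cong (inI₁ (σ a) *_) (coeff-if-[] (σ b) _ k)) (sym (*-assoc (inI₁ (σ a)) _ _)))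

  cell : Cube N → Fin N × Fin N → Poly
  cell σ x = Ucell (σ (proj₁ x)) (σ (proj₂ x))

  coeff₀-cell : ∀ σ x → coeff (cell σ x) 0 ≡ - 1ℚ
  coeff₀-cell σ x = coeff₀-Ucell (σ (proj₁ x)) (σ (proj₂ x))

  coeff₀-4fab : coeff (scale (1ℚ + 1ℚ + 1ℚ + 1ℚ) (fabH H a b)) 0 ≡ coeff (pm1 ^ᴾ e H) 0
  coeff₀-4fab = begin
    coeff (scale (1ℚ + 1ℚ + 1ℚ + 1ℚ) (fabH H a b)) 0
      ≡⟨ coeff-4fab 0 ⟩
    𝔼₁ (λ σ → coeff (edgeProd H σ) 0)
      ≡⟨ 𝔼₁-cong (λ σ → coeff₀-∏ᴾ (cell σ) (coeff₀-cell σ) (edges H)) ⟩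
    𝔼₁ (λ _ → (- 1ℚ) ^ e H)
      ≡⟨ 𝔼₁-const ((- 1ℚ) ^ e H) ⟩
    (- 1ℚ) ^ e H
      ≡⟨ sym (coeff₀-∏ᴾ (λ _ → pm1) (λ _ → refl) (edges H)) ⟩
    coeff (∏ᴾ (λ _ → pm1) (edges H)) 0
      ≡⟨ cong (λ P → coeff P 0) (sym (^ᴾ-length pm1 (edges H))) ⟩
    coeff (pm1 ^ᴾ e H) 0
      ∎
    where open ≡-Reasoning

  coeff₁-4fab : coeff (scale (1ℚ + 1ℚ + 1ℚ + 1ℚ) (fabH H a b)) 1 ≡ coeff (pm1 ^ᴾ e H) 1
  coeff₁-4fab = begin
    coeff (scale (1ℚ + 1ℚ + 1ℚ + 1ℚ) (fabH H a b)) 1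
      ≡⟨ coeff-4fab 1 ⟩
    𝔼₁ (λ σ → coeff (edgeProd H σ) 1)
      ≡⟨ 𝔼₁-cong (λ σ → trans (coeff₁-∏ᴾ (cell σ) (coeff₀-cell σ) E) (neg-distribˡ-* s _)) ⟩
    𝔼₁ (λ σ → - s * sumℚ (map (λ x → coeff (cell σ x) 1) E))
      ≡⟨ 𝔼₁-*ˡ (- s) _ ⟩
    - s * 𝔼₁ (λ σ → sumℚ (map (λ x → coeff (cell σ x) 1) E))
      ≡⟨ cong (- s *_) (𝔼₁-sumℚ (λ x σ → coeff (cell σ x) 1) E) ⟩
    - s * sumℚ (map (λ x → 𝔼₁ (λ σ → coeff (cell σ x) 1)) E)
      ≡⟨ cong (- s *_) (sumℚ-congᴬ (All.map (λ (u≢w , uw∈E) → 𝔼₁-coeff₁-Ucell u≢w uw∈E) (edges-adjacent H))) ⟩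
    - s * sumℚ (map (λ _ → coeff pm1 1) E)
      ≡⟨ sym (neg-distribˡ-* s _) ⟩
    - (s * sumℚ (map (λ _ → coeff pm1 1) E))
      ≡⟨ sym (coeff₁-∏ᴾ (λ _ → pm1) (λ _ → refl) E) ⟩
    coeff (∏ᴾ (λ _ → pm1) E) 1
      ≡⟨ cong (λ P → coeff P 1) (sym (^ᴾ-length pm1 E)) ⟩
    coeff (pm1 ^ᴾ e H) 1
      ∎
    where
    open ≡-Reasoning
    E = edges H
    s = (- 1ℚ) ^ e H

lemma3p3 : (H : Graph) (a b : Fin' H) → a ≢ b → adj H a b ≡ false →
    p²∣ ΔH H → p²∣ (scale (1ℚ + 1ℚ + 1ℚ + 1ℚ) (fabH H a b) ⊝ (pm1 ^ᴾ e H))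
lemma3p3 H a b a≢b ab∉E _ =
  p²∣-intro (4fab ⊝ (pm1 ^ᴾ e H)) (coeff-⊝ 4fab (pm1 ^ᴾ e H) 0 coeff₀-4fab) (coeff-⊝ 4fab (pm1 ^ᴾ e H) 1 coeff₁-4fab)
  where
  open SelectedPair H a b a≢b ab∉E
  4fab = scale (1ℚ + 1ℚ + 1ℚ + 1ℚ) (fabH H a b)
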